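{- Let $x=\mathsf I\,x^-$ be a nonempty reduced word over $\mathcal A$ (first letter $\mathsf I$, remainder $x^-$), let $\mathcal X$ be the class represented by $x$ and $\mathcal X^-$ the class represented by $x^-$. A permutation $\pi$ belongs to $\mathcal X^-$ if and only if $\pi$ is contained in a sum-indecomposable permutation belonging to $\mathcal X$.
   Context: $\mathcal C[\mathcal E]$ is the set of inflations $\sigma[\tau_1,\dots,\tau_k]$ with $\sigma\in\mathcal C$, $\tau_i\in\mathcal E$. The alphabet is $\mathcal A=\{\mathsf I,\mathsf D,\mathrm{Av}(213),\mathrm{Av}(312),\mathrm{Av}(132),\mathrm{Av}(231)\}$ ($\mathsf I,\mathsf D$ increasing and decreasing permutations). A word $w_1\cdots w_n$ represents $w_1[w_2[\cdots[w_n]\cdots]]$; the empty word represents $\{\emptyset,1\}$. A word is reduced if it has no two consecutive letters among $\mathsf I\mathsf I$, $\mathsf D\mathsf D$, $\mathsf I\,\mathrm{Av}(312)$, $\mathsf I\,\mathrm{Av}(231)$, $\mathsf D\,\mathrm{Av}(132)$, $\mathsf D\,\mathrm{Av}(213)$, $\mathrm{Av}(312)\,\mathsf D$, $\mathrm{Av}(231)\,\mathsf D$, $\mathrm{Av}(132)\,\mathsf I$, $\mathrm{Av}(213)\,\mathsf I$. -}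

module Defs where

open import Data.Nat using (ℕ; zero; suc; _+_; _<ᵇ_)
open import Data.Bool using (Bool; true; false; if_then_else_)
open import Data.List using (List; []; _∷_; _++_; map; length; upTo; reverse; concat; zipWith; zip; filterᵇ)
open import Data.Nat.ListAction using (sum)
open import Data.List.Relation.Unary.All using (All)
open import Data.List.Relation.Binary.Permutation.Propositional using (_↭_)
open import Data.List.Relation.Binary.Sublist.Propositional using (_⊆_)
open import Data.Product using (Σ; ∃; _×_; _,_)
open import Data.Sum using (_⊎_)
open import Relation.Binary.PropositionalEquality using (_≡_; _≢_)
open import Relation.Nullary using (¬_)

-- Permutations in one-line notation on the values 0,1,…,n-1.
Perm : Set
Perm = List ℕ

IsPerm : Perm → Set
IsPerm π = π ↭ upTo (length π)

PermClass : Set₁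
PermClass = Perm → Set

-- Standardisation (order-isomorphic pattern) of a list of distinct naturals.
st : List ℕ → Perm
st s = map (λ x → length (filterᵇ (λ y → y <ᵇ x) s)) s

_≼_ : Perm → Perm → Set
π ≼ σ = Σ (List ℕ) λ s → (s ⊆ σ) × (st s ≡ π)

Av : Perm → PermClass
Av β π = IsPerm π × ¬ (β ≼ π)

Incr : PermClass
Incr π = π ≡ upTo (length π)

Decr : PermClass
Decr π = π ≡ reverse (upTo (length π))

-- Inflation σ[τ₁,…,τ_k] (τs has length k = |σ|).
offset : Perm → List Perm → ℕ → ℕ
offset σ τs a = sum (map (λ p → if Data.Product.proj₁ p <ᵇ a then length (Data.Product.proj₂ p) else 0) (zip σ τs))

inflate : Perm → List Perm → Perm
inflate σ τs = concat (zipWith (λ a τ → map (offset σ τs a +_) τ) σ τs)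

_[_] : PermClass → PermClass → PermClass
(C [ E ]) π = Σ Perm λ σ → Σ (List Perm) λ τs →
  C σ × (length τs ≡ length σ) × All (λ τ → E τ × (τ ≢ [])) τs × (inflate σ τs ≡ π)

data Letter : Set where
  I D Av213 Av312 Av132 Av231 : Letter

letterClass : Letter → PermClass
letterClass I = Incr
letterClass D = Decr
letterClass Av213 = Av (1 ∷ 0 ∷ 2 ∷ [])
letterClass Av312 = Av (2 ∷ 0 ∷ 1 ∷ [])
letterClass Av132 = Av (0 ∷ 2 ∷ 1 ∷ [])
letterClass Av231 = Av (1 ∷ 2 ∷ 0 ∷ [])

Word : Set
Word = List Letter

represent : Word → PermClass
represent [] π = (π ≡ []) ⊎ (π ≡ 0 ∷ [])
represent (l ∷ w) = letterClass l [ represent w ]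

forbidden : Letter → Letter → Bool
forbidden I I = true
forbidden D D = true
forbidden I Av312 = true
forbidden I Av231 = true
forbidden D Av132 = true
forbidden D Av213 = true
forbidden Av312 D = true
forbidden Av231 D = true
forbidden Av132 I = true
forbidden Av213 I = true
forbidden _ _ = false

Reduced : Word → Set
Reduced [] = Data.Unit.⊤ where import Data.Unit
Reduced (a ∷ []) = Data.Unit.⊤ where import Data.Unit
Reduced (a ∷ b ∷ w) = (forbidden a b ≡ false) × Reduced (b ∷ w)

_⊕_ : Perm → Perm → Perm
α ⊕ β = α ++ map (length α +_) β

SumIndecomposable : Perm → Set
SumIndecomposable π = (π ≢ []) ×
  (∀ α β → IsPerm α → IsPerm β → α ≢ [] → β ≢ [] → α ⊕ β ≢ π)

-- Write σ ∈ 𝒳 as an inflation 12⋯k[τ₁,…,τₖ] = τ₁ ⊕ ⋯ ⊕ τₖ with τᵢ ∈ 𝒳⁻. If σ is sum-indecomposable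
-- then k = 1, so σ ∈ 𝒳⁻, and every π ≼ σ lies in 𝒳⁻ because classes represented by words are
-- closed under containment: a pattern in an inflation C[E] is the inflation of the standardised
-- labels it uses (a pattern of the skeleton) by the standardised pieces of the blocks it meets.
-- Conversely, as x is reduced, x⁻ is empty or starts with D, Av(213) or Av(132); these classes,
-- and hence their inflations by a class containing 1, are closed under placing a new maximum in
-- front. So π ∈ 𝒳⁻ lies in (n+1)π ∈ 𝒳⁻ ⊆ 𝒳 = I[𝒳⁻], which is sum-indecomposable since its first
-- entry is its maximum.

module Submission where

open import Defs
open import Data.Bool using (true; false; if_then_else_; T)
open import Data.Bool.Properties using (T?)
open import Data.Empty using (⊥-elim)
open import Data.List
  using (List; []; _∷_; _++_; map; applyUpTo; length; upTo; downFrom; reverse; filterᵇ; concat; zip; zipWith)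
open import Data.Nat.ListAction using (sum)
open import Data.List.Properties
  using (∷-injectiveˡ; ∷-injectiveʳ; ++-identityʳ; length-++; length-map; length-filter; length-upTo; length-downFrom;
         map-∘; map-++; map-cong; map-id; map-id-local; map-upTo; zip-map; filter-all; filter-++; reverse-upTo; upTo-∷ʳ)
open import Data.List.Membership.Propositional using (_∈_)
open import Data.List.Membership.Propositional.Properties using (∈-∃++; ∈-upTo⁻; ∈-map⁺)
open import Data.List.Relation.Binary.Permutation.Propositional
  using (_↭_; prep; ↭-refl; ↭-sym; ↭-trans; ↭⇒↭ₛ)
open import Data.List.Relation.Binary.Permutation.Propositional.Properties
  using (All-resp-↭; ∈-resp-↭; filter-↭; shift; ↭-length; ∷↭∷ʳ; ↭-reverse)
import Data.List.Relation.Binary.Permutation.Setoid.Properties as ↭ₛ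
open import Data.List.Relation.Binary.Pointwise as Pointwise using (Pointwise; []; _∷_)
open import Data.List.Relation.Binary.Sublist.Propositional using (_⊆_; []; _∷_; _∷ʳ_; ⊆-refl; ⊆-trans)
open import Data.List.Relation.Binary.Sublist.Propositional.Properties using (All-resp-⊆)
open import Data.List.Relation.Unary.All as All using (All; []; _∷_)
import Data.List.Relation.Unary.All.Properties as All
open import Data.List.Relation.Unary.AllPairs using (AllPairs; []; _∷_)
import Data.List.Relation.Unary.AllPairs.Properties as AllPairs
open import Data.List.Relation.Unary.Any using (here; there)
open import Data.List.Relation.Unary.Unique.Propositional using (Unique)
import Data.List.Relation.Unary.Unique.Propositional.Properties as Unique
open import Data.Nat using (ℕ; zero; suc; _+_; _<ᵇ_; _<_; _≤_; _>_; _⊓_; z≤n; s≤s; z<s)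
open import Data.Nat.Properties
open import Data.List.Membership.DecPropositional _≟_ using (_∈?_)
open import Data.Product as Product using (Σ; _×_; _,_; proj₁; proj₂)
open import Data.Sum using (inj₁; inj₂)
open import Function.Base using (id; _∘_)
open import Function.Bundles using (_⇔_; mk⇔)
open import Relation.Binary.Definitions using (tri<; tri≈; tri>)
open import Relation.Binary.PropositionalEquality hiding ([_])
open import Relation.Binary.PropositionalEquality.Properties using (setoid)
open import Relation.Nullary using (¬_; yes; no)

<⇒<ᵇ≡true : ∀ {m n} → m < n → (m <ᵇ n) ≡ true
<⇒<ᵇ≡true {m} {n} m<n with m <ᵇ n | <⇒<ᵇ m<n
... | true | _ = refl

≮⇒<ᵇ≡false : ∀ {m n} → ¬ m < n → (m <ᵇ n) ≡ false
≮⇒<ᵇ≡false {m} {n} m≮n with m <ᵇ n in eq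
... | false = refl
... | true = ⊥-elim (m≮n (<ᵇ⇒< m n (subst T (sym eq) _)))

<ᵇ≡true⇒< : ∀ {m n} → (m <ᵇ n) ≡ true → m < n
<ᵇ≡true⇒< {m} {n} eq = <ᵇ⇒< m n (subst T (sym eq) _)

n<ᵇn≡false : ∀ n → (n <ᵇ n) ≡ false
n<ᵇn≡false n = ≮⇒<ᵇ≡false (n≮n n)

+-cancelˡ-<ᵇ : ∀ k m n → ((k + m) <ᵇ (k + n)) ≡ (m <ᵇ n)
+-cancelˡ-<ᵇ zero    m n = refl
+-cancelˡ-<ᵇ (suc k) m n = +-cancelˡ-<ᵇ k m n

rank : List ℕ → ℕ → ℕ
rank s x = length (filterᵇ (_<ᵇ x) s)

rank-∷ : ∀ y s x → rank (y ∷ s) x ≡ (if y <ᵇ x then suc (rank s x) else rank s x)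
rank-∷ y s x with y <ᵇ x
... | true  = refl
... | false = refl

rank-mono-≤ : ∀ s {a b} → a ≤ b → rank s a ≤ rank s b
rank-mono-≤ []      a≤b = z≤n
rank-mono-≤ (y ∷ s) {a} {b} a≤b rewrite rank-∷ y s a | rank-∷ y s b with y <ᵇ a in ea | y <ᵇ b in eb
... | true  | true  = s≤s (rank-mono-≤ s a≤b)
... | false | false = rank-mono-≤ s a≤b
... | false | true  = m≤n⇒m≤1+n (rank-mono-≤ s a≤b)
... | true  | false = ⊥-elim (subst T eb (<⇒<ᵇ (<-≤-trans (<ᵇ≡true⇒< ea) a≤b)))

rank-mono-< : ∀ s {a b} → a ∈ s → a < b → rank s a < rank s b
rank-mono-< (y ∷ s) {a} {b} (here refl) a<b
  rewrite rank-∷ a s a | rank-∷ a s b | n<ᵇn≡false a | <⇒<ᵇ≡true a<b = s≤s (rank-mono-≤ s (<⇒≤ a<b))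
rank-mono-< (y ∷ s) {a} {b} (there a∈s) a<b rewrite rank-∷ y s a | rank-∷ y s b with y <ᵇ a in ea | y <ᵇ b in eb
... | true  | true  = s≤s (rank-mono-< s a∈s a<b)
... | false | false = rank-mono-< s a∈s a<b
... | false | true  = m≤n⇒m≤1+n (rank-mono-< s a∈s a<b)
... | true  | false = ⊥-elim (subst T eb (<⇒<ᵇ (<-trans (<ᵇ≡true⇒< ea) a<b)))

-- Order isomorphism

Agree : ℕ → ℕ → ℕ → ℕ → Set
Agree x y x′ y′ = ((x′ <ᵇ x) ≡ (y′ <ᵇ y)) × ((x <ᵇ x′) ≡ (y <ᵇ y′))

AgreeAll : ℕ → ℕ → List ℕ → List ℕ → Set
AgreeAll x y = Pointwise (Agree x y)

agree-< : ∀ {x y x′ y′} → x < x′ → y < y′ → Agree x y x′ y′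
agree-< x<x′ y<y′ = trans (≮⇒<ᵇ≡false (<⇒≯ x<x′)) (sym (≮⇒<ᵇ≡false (<⇒≯ y<y′))) ,
                    trans (<⇒<ᵇ≡true x<x′) (sym (<⇒<ᵇ≡true y<y′))

agree-> : ∀ {x y x′ y′} → x′ < x → y′ < y → Agree x y x′ y′
agree-> x′<x y′<y = trans (<⇒<ᵇ≡true x′<x) (sym (<⇒<ᵇ≡true y′<y)) ,
                    trans (≮⇒<ᵇ≡false (<⇒≯ x′<x)) (sym (≮⇒<ᵇ≡false (<⇒≯ y′<y)))

data OrderIso : List ℕ → List ℕ → Set where
  [] : OrderIso [] []
  _∷_ : ∀ {x y s t} → AgreeAll x y s t → OrderIso s t → OrderIso (x ∷ s) (y ∷ t)

st-cong : ∀ {s t} → OrderIso s t → st s ≡ st t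
st-cong = map-pointwise ∘ Pointwise.map (λ {x} {y} → rank-cong x y) ∘ rows
  where
  Row : ℕ → ℕ → List ℕ → List ℕ → Set
  Row x y = Pointwise (λ x′ y′ → (x′ <ᵇ x) ≡ (y′ <ᵇ y))

  rows : ∀ {s t} → OrderIso s t → Pointwise (λ x y → Row x y s t) s t
  rows [] = []
  rows {x ∷ s} {y ∷ t} (xy ∷ iso) =
    (trans (n<ᵇn≡false x) (sym (n<ᵇn≡false y)) ∷ Pointwise.map proj₁ xy)
    ∷ prependColumn xy (rows iso)
    where
    prependColumn : ∀ {x y s t u v} → AgreeAll x y u v →
      Pointwise (λ x′ y′ → Row x′ y′ s t) u v →
      Pointwise (λ x′ y′ → Row x′ y′ (x ∷ s) (y ∷ t)) u v
    prependColumn [] [] = []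
    prependColumn (ag ∷ ags) (row ∷ rows) = (proj₂ ag ∷ row) ∷ prependColumn ags rows

  rank-cong : ∀ x y {s t} → Row x y s t → rank s x ≡ rank t y
  rank-cong x y [] = refl
  rank-cong x y {x′ ∷ s} {y′ ∷ t} (e ∷ row) rewrite rank-∷ x′ s x | rank-∷ y′ t y | e with y′ <ᵇ y
  ... | true  = cong suc (rank-cong x y row)
  ... | false = rank-cong x y row

  map-pointwise : ∀ {f g : ℕ → ℕ} {s t} → Pointwise (λ x y → f x ≡ g y) s t → map f s ≡ map g t
  map-pointwise [] = refl
  map-pointwise (e ∷ es) = cong₂ _∷_ e (map-pointwise es)

<ᵇ-preserved : ∀ (P : ℕ → Set) (f : ℕ → ℕ) → (∀ {a b} → P a → P b → a < b → f a < f b) →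
  ∀ {a b} → P a → P b → (a <ᵇ b) ≡ (f a <ᵇ f b)
<ᵇ-preserved P f mono {a} {b} pa pb with <-cmp a b
... | tri< a<b _ _ = trans (<⇒<ᵇ≡true a<b) (sym (<⇒<ᵇ≡true (mono pa pb a<b)))
... | tri≈ _ refl _ = trans (n<ᵇn≡false a) (sym (n<ᵇn≡false (f a)))
... | tri> _ _ b<a = trans (≮⇒<ᵇ≡false (<⇒≯ b<a)) (sym (≮⇒<ᵇ≡false (<⇒≯ (mono pb pa b<a))))

orderIso-map : ∀ (P : ℕ → Set) (f : ℕ → ℕ) → (∀ {a b} → P a → P b → a < b → f a < f b) →
  ∀ {s} → All P s → OrderIso s (map f s)
orderIso-map P f mono [] = []
orderIso-map P f mono {x ∷ s} (px ∷ ps) = agree ps ∷ orderIso-map P f mono ps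
  where
  agree : ∀ {t} → All P t → AgreeAll x (f x) t (map f t)
  agree [] = []
  agree (pt ∷ pts) = (<ᵇ-preserved P f mono pt px , <ᵇ-preserved P f mono px pt) ∷ agree pts

orderIso-st : ∀ s → OrderIso s (st s)
orderIso-st s = orderIso-map (_∈ s) (rank s) (λ a∈s _ → rank-mono-< s a∈s) (All.tabulate id)

orderIso-shift : ∀ k k′ {s t} → OrderIso s t → OrderIso (map (k +_) s) (map (k′ +_) t)
orderIso-shift k k′ [] = []
orderIso-shift k k′ (xy ∷ p) = agree-shift xy ∷ orderIso-shift k k′ p
  where
  shift-<ᵇ : ∀ a b c d → (a <ᵇ b) ≡ (c <ᵇ d) → ((k + a) <ᵇ (k + b)) ≡ ((k′ + c) <ᵇ (k′ + d))
  shift-<ᵇ a b c d e = trans (+-cancelˡ-<ᵇ k a b) (trans e (sym (+-cancelˡ-<ᵇ k′ c d)))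

  agree-shift : ∀ {x y s t} → AgreeAll x y s t → AgreeAll (k + x) (k′ + y) (map (k +_) s) (map (k′ +_) t)
  agree-shift [] = []
  agree-shift {x} {y} {x′ ∷ _} {y′ ∷ _} ((a , b) ∷ p) =
    (shift-<ᵇ x′ x y′ y a , shift-<ᵇ x x′ y y′ b) ∷ agree-shift p

-- The entries of s at the positions that u occupies in t.
select : ∀ {u t : List ℕ} → u ⊆ t → List ℕ → List ℕ
select []       _       = []
select (_ ∷ʳ p) []      = []
select (_ ∷ʳ p) (_ ∷ s) = select p s
select (_ ∷ p)  []      = []
select (_ ∷ p)  (x ∷ s) = x ∷ select p s

orderIso-select : ∀ {s t u} → OrderIso s t → (p : u ⊆ t) → OrderIso (select p s) u
orderIso-select [] [] = []
orderIso-select (_ ∷ iso) (_ ∷ʳ p) = orderIso-select iso p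
orderIso-select (xy ∷ iso) (refl ∷ p) = agree-select xy p ∷ orderIso-select iso p
  where
  agree-select : ∀ {x y s t u} → AgreeAll x y s t → (p : u ⊆ t) → AgreeAll x y (select p s) u
  agree-select [] [] = []
  agree-select (_ ∷ xy) (_ ∷ʳ p) = agree-select xy p
  agree-select (a ∷ xy) (refl ∷ p) = a ∷ agree-select xy p

select-⊆ : ∀ {s t u} → OrderIso s t → (p : u ⊆ t) → select p s ⊆ s
select-⊆ [] [] = []
select-⊆ {x ∷ _} (_ ∷ iso) (_ ∷ʳ p) = x ∷ʳ select-⊆ iso p
select-⊆ (_ ∷ iso) (refl ∷ p) = refl ∷ select-⊆ iso p

≼-trans : ∀ {β π σ} → β ≼ π → π ≼ σ → β ≼ σ
≼-trans (t , t⊆π , refl) (s , s⊆σ , refl) =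
  select t⊆π s , ⊆-trans (select-⊆ iso t⊆π) s⊆σ , st-cong (orderIso-select iso t⊆π)
  where
  iso : OrderIso s (st s)
  iso = orderIso-st s

Unique-resp-↭ : ∀ {xs ys : List ℕ} → xs ↭ ys → Unique xs → Unique ys
Unique-resp-↭ p = ↭ₛ.Unique-resp-↭ (setoid ℕ) (↭⇒↭ₛ p)

AllPairs-resp-⊆ : ∀ {R : ℕ → ℕ → Set} {xs ys} → xs ⊆ ys → AllPairs R ys → AllPairs R xs
AllPairs-resp-⊆ [] [] = []
AllPairs-resp-⊆ (_ ∷ʳ p) (_ ∷ rs) = AllPairs-resp-⊆ p rs
AllPairs-resp-⊆ (refl ∷ p) (r ∷ rs) = All-resp-⊆ p r ∷ AllPairs-resp-⊆ p rs

rank-resp-↭ : ∀ {xs ys} v → xs ↭ ys → rank xs v ≡ rank ys v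
rank-resp-↭ v p = ↭-length (filter-↭ (T? ∘ (_<ᵇ v)) p)

rank-++ : ∀ xs ys v → rank (xs ++ ys) v ≡ rank xs v + rank ys v
rank-++ xs ys v = trans (cong length (filter-++ (T? ∘ (_<ᵇ v)) xs ys)) (length-++ (filterᵇ (_<ᵇ v) xs))

rank-≤-length : ∀ s x → rank s x ≤ length s
rank-≤-length s x = length-filter (T? ∘ (_<ᵇ x)) s

rank-<-length : ∀ s {x} → x ∈ s → rank s x < length s
rank-<-length (y ∷ s) {x} (here refl) rewrite rank-∷ x s x | n<ᵇn≡false x = s≤s (rank-≤-length s x)
rank-<-length (y ∷ s) {x} (there x∈s) rewrite rank-∷ y s x with y <ᵇ x
... | true  = s≤s (rank-<-length s x∈s)
... | false = m≤n⇒m≤1+n (rank-<-length s x∈s)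

rank-of-bound : ∀ {n} s → All (_< n) s → rank s n ≡ length s
rank-of-bound s s<n = cong length (filter-all (T? ∘ _) (All.map <⇒<ᵇ s<n))

rank-upTo : ∀ n v → rank (upTo n) v ≡ n ⊓ v
rank-upTo zero v = refl
rank-upTo (suc n) v = begin
  rank (upTo (suc n)) v        ≡⟨ cong (λ l → rank l v) (sym (upTo-∷ʳ n)) ⟩
  rank (upTo n ++ (n ∷ [])) v     ≡⟨ rank-++ (upTo n) (n ∷ []) v ⟩
  rank (upTo n) v + rank (n ∷ []) v ≡⟨ cong (_+ rank (n ∷ []) v) (rank-upTo n v) ⟩
  n ⊓ v + rank (n ∷ []) v         ≡⟨ last-step ⟩
  suc n ⊓ v                    ∎
  where
  open ≡-Reasoning
  last-step : n ⊓ v + rank (n ∷ []) v ≡ suc n ⊓ v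
  last-step rewrite rank-∷ n [] v with <-cmp n v
  ... | tri< n<v _ _ rewrite <⇒<ᵇ≡true n<v | m≤n⇒m⊓n≡m (<⇒≤ n<v) | m≤n⇒m⊓n≡m n<v = +-comm n 1
  ... | tri≈ _ refl _ rewrite n<ᵇn≡false n | m≥n⇒m⊓n≡n (n≤1+n n) | ⊓-idem n = +-identityʳ n
  ... | tri> _ _ v<n
    rewrite ≮⇒<ᵇ≡false (<⇒≯ v<n) | m≥n⇒m⊓n≡n (<⇒≤ v<n) | m≥n⇒m⊓n≡n (m≤n⇒m≤1+n (<⇒≤ v<n)) = +-identityʳ v

isPerm⇒bounded : ∀ {π} → IsPerm π → All (_< length π) π
isPerm⇒bounded p = All.tabulate (λ v∈π → ∈-upTo⁻ (∈-resp-↭ p v∈π))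

isPerm⇒unique : ∀ {π} → IsPerm π → Unique π
isPerm⇒unique {π} p = Unique-resp-↭ (↭-sym p) (Unique.upTo⁺ (length π))

st-fixes-perm : ∀ {π} → IsPerm π → st π ≡ π
st-fixes-perm {π} p = map-id-local (All.map rank-self (isPerm⇒bounded p))
  where
  rank-self : ∀ {v} → v < length π → rank π v ≡ v
  rank-self {v} v<n = trans (rank-resp-↭ v p) (trans (rank-upTo (length π) v) (m≥n⇒m⊓n≡n (<⇒≤ v<n)))

private
  <-suc-≢ : ∀ {v n} → v < suc n → v ≢ n → v < n
  <-suc-≢ (s≤s v≤n) v≢n = ≤∧≢⇒< v≤n v≢n

  remove-top : ∀ {xs n} → n ∈ xs → Unique xs → All (_< suc n) xs →
    Σ (List ℕ) λ ys → (xs ↭ n ∷ ys) × Unique ys × All (_< n) ys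
  remove-top {n = n} n∈xs u bd with ∈-∃++ n∈xs
  ... | ys , zs , refl with Unique-resp-↭ (shift n ys zs) u | All-resp-↭ (shift n ys zs) bd
  ... | (n∉ ∷ u′) | (_ ∷ bd′) =
    ys ++ zs , shift n ys zs , u′ , All.zipWith (λ (v< , n≢v) → <-suc-≢ v< (n≢v ∘ sym)) (bd′ , n∉)

  below-if-absent : ∀ {xs n} → ¬ n ∈ xs → All (_< suc n) xs → All (_< n) xs
  below-if-absent {xs} n∉xs bd = All.map (λ (v< , v∈) → <-suc-≢ v< (λ { refl → n∉xs v∈ }))
    (All.zip (bd , All.tabulate {xs = xs} id))

∷-upTo↭upTo-suc : ∀ n → n ∷ upTo n ↭ upTo (suc n)
∷-upTo↭upTo-suc n = subst (n ∷ upTo n ↭_) (upTo-∷ʳ n) (∷↭∷ʳ n (upTo n))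

unique-bounded⇒length≤ : ∀ n {xs} → Unique xs → All (_< n) xs → length xs ≤ n
unique-bounded⇒length≤ zero {[]} u bd = z≤n
unique-bounded⇒length≤ zero {_ ∷ _} u (() ∷ _)
unique-bounded⇒length≤ (suc n) {xs} u bd with n ∈? xs
... | no  n∉xs = m≤n⇒m≤1+n (unique-bounded⇒length≤ n u (below-if-absent n∉xs bd))
... | yes n∈xs with remove-top n∈xs u bd
... | ys , xs↭ , u′ , bd′ rewrite ↭-length xs↭ = s≤s (unique-bounded⇒length≤ n u′ bd′)

unique-bounded⇒↭upTo : ∀ n {xs} → Unique xs → All (_< n) xs → length xs ≡ n → xs ↭ upTo n
unique-bounded⇒↭upTo zero {[]} u bd len = ↭-refl
unique-bounded⇒↭upTo (suc n) {xs} u bd len with n ∈? xs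
... | no n∉xs = ⊥-elim (<⇒≱ (≤-reflexive (sym len)) (unique-bounded⇒length≤ n u (below-if-absent n∉xs bd)))
... | yes n∈xs with remove-top n∈xs u bd
... | ys , xs↭ , u′ , bd′ = ↭-trans xs↭ (↭-trans (prep n ys↭) (∷-upTo↭upTo-suc n))
  where
  ys↭ : ys ↭ upTo n
  ys↭ = unique-bounded⇒↭upTo n u′ bd′ (suc-injective (trans (sym (↭-length xs↭)) len))

unique-map⁺ : ∀ (P : ℕ → Set) (f : ℕ → ℕ) → (∀ {a b} → P a → P b → a ≢ b → f a ≢ f b) →
  ∀ {xs} → All P xs → Unique xs → Unique (map f xs)
unique-map⁺ P f inj [] [] = []
unique-map⁺ P f inj (px ∷ pxs) (x∉ ∷ u) =
  All.map⁺ (All.zipWith (λ (x≢y , py) → inj px py x≢y) (x∉ , pxs)) ∷ unique-map⁺ P f inj pxs u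

rank-injective : ∀ s {a b} → a ∈ s → b ∈ s → a ≢ b → rank s a ≢ rank s b
rank-injective s {a} {b} a∈s b∈s a≢b with <-cmp a b
... | tri< a<b _ _ = <⇒≢ (rank-mono-< s a∈s a<b)
... | tri≈ _ a≡b _ = ⊥-elim (a≢b a≡b)
... | tri> _ _ b<a = ≢-sym (<⇒≢ (rank-mono-< s b∈s b<a))

st-isPerm : ∀ {s} → Unique s → IsPerm (st s)
st-isPerm {s} u = subst (λ n → st s ↭ upTo n) (sym (length-map (rank s) s))
  (unique-bounded⇒↭upTo (length s) (unique-map⁺ (_∈ s) (rank s) (rank-injective s) (All.tabulate id) u)
    (All.map⁺ (All.tabulate (rank-<-length s))) (length-map (rank s) s))

upTo-isPerm : ∀ n → IsPerm (upTo n)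
upTo-isPerm n = subst (λ m → upTo n ↭ upTo m) (sym (length-upTo n)) ↭-refl

downFrom-isPerm : ∀ n → IsPerm (downFrom n)
downFrom-isPerm n = subst₂ (λ l m → l ↭ upTo m) (reverse-upTo n) (sym (length-downFrom n)) (↭-reverse (upTo n))

ContainmentClosed : PermClass → Set
ContainmentClosed C = ∀ {π σ} → C σ → π ≼ σ → C π

OnlyPerms : PermClass → Set
OnlyPerms C = ∀ {π} → C π → IsPerm π

monotone-orderIso : ∀ (R : ℕ → ℕ → Set) →
  (∀ {x y x′ y′} → R x x′ → R y y′ → Agree x y x′ y′) →
  ∀ {s t} → AllPairs R s → AllPairs R t → length s ≡ length t → OrderIso s t
monotone-orderIso R agree [] [] refl = []
monotone-orderIso R agree (rx ∷ rs) (ry ∷ rt) len =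
  agreeAll rx ry (suc-injective len) ∷ monotone-orderIso R agree rs rt (suc-injective len)
  where
  agreeAll : ∀ {x y s t} → All (R x) s → All (R y) t → length s ≡ length t → AgreeAll x y s t
  agreeAll [] [] refl = []
  agreeAll (r ∷ rs) (r′ ∷ rs′) len′ = agree r r′ ∷ agreeAll rs rs′ (suc-injective len′)

Incr-closed : ContainmentClosed Incr
Incr-closed {σ = σ} σ≡ (s , s⊆σ , refl) = begin
  st s
    ≡⟨ st-cong (monotone-orderIso _<_ agree-< s↑ (upTo↑ (length s)) (sym (length-upTo _))) ⟩
  st (upTo (length s))  ≡⟨ st-fixes-perm (upTo-isPerm (length s)) ⟩
  upTo (length s)       ≡⟨ cong upTo (sym (length-map (rank s) s)) ⟩
  upTo (length (st s))  ∎
  where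
  open ≡-Reasoning
  upTo↑ : ∀ n → AllPairs _<_ (upTo n)
  upTo↑ n = AllPairs.applyUpTo⁺₁ id n (λ i<j _ → i<j)
  s↑ : AllPairs _<_ s
  s↑ = AllPairs-resp-⊆ (subst (s ⊆_) σ≡ s⊆σ) (upTo↑ (length σ))

Decr-closed : ContainmentClosed Decr
Decr-closed {σ = σ} σ≡ (s , s⊆σ , refl) = begin
  st s
    ≡⟨ st-cong (monotone-orderIso _>_ agree-> s↓ (downFrom↓ (length s)) (sym (length-downFrom _))) ⟩
  st (downFrom (length s)) ≡⟨ st-fixes-perm (downFrom-isPerm (length s)) ⟩
  downFrom (length s)      ≡⟨ sym (reverse-upTo (length s)) ⟩
  reverse (upTo (length s)) ≡⟨ cong (reverse ∘ upTo) (sym (length-map (rank s) s)) ⟩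
  reverse (upTo (length (st s))) ∎
  where
  open ≡-Reasoning
  downFrom↓ : ∀ n → AllPairs _>_ (downFrom n)
  downFrom↓ n = AllPairs.applyDownFrom⁺₁ id n (λ j<i _ → j<i)
  s↓ : AllPairs _>_ s
  s↓ = AllPairs-resp-⊆ (subst (s ⊆_) (trans σ≡ (reverse-upTo (length σ))) s⊆σ) (downFrom↓ (length σ))

Av-closed : ∀ β → ContainmentClosed (Av β)
Av-closed β (σ-perm , β⋠σ) (s , s⊆σ , refl) =
  st-isPerm (AllPairs-resp-⊆ s⊆σ (isPerm⇒unique σ-perm)) ,
  λ β≼ → β⋠σ (≼-trans β≼ (s , s⊆σ , refl))

Incr-onlyPerms : OnlyPerms Incr
Incr-onlyPerms {π} π≡ = subst IsPerm (sym π≡) (upTo-isPerm (length π))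

Decr-onlyPerms : OnlyPerms Decr
Decr-onlyPerms {π} π≡ = subst IsPerm (sym (trans π≡ (reverse-upTo (length π)))) (downFrom-isPerm (length π))

-- Inflation as a concatenation of shifted blocks

Block : Set
Block = ℕ × Perm

weight : ℕ → Block → ℕ
weight a (c , τ) = if c <ᵇ a then length τ else 0

-- offsets (zip σ τs) unfolds to offset σ τs.
offsets : List Block → ℕ → ℕ
offsets ps a = sum (map (weight a) ps)

shiftedBlock : (ℕ → ℕ) → Block → List ℕ
shiftedBlock F (c , τ) = map (F c +_) τ

inflateBlocks : List Block → Perm
inflateBlocks ps = concat (map (shiftedBlock (offsets ps)) ps)

size : List Block → ℕ
size ps = sum (map (length ∘ proj₂) ps)

inflate≡inflateBlocks : ∀ σ τs → inflate σ τs ≡ inflateBlocks (zip σ τs)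
inflate≡inflateBlocks σ τs = cong concat (zipWith≡map-zip (offset σ τs) σ τs)
  where
  zipWith≡map-zip : ∀ F xs ys → zipWith (λ a τ → map (F a +_) τ) xs ys ≡ map (shiftedBlock F) (zip xs ys)
  zipWith≡map-zip F [] _ = refl
  zipWith≡map-zip F (_ ∷ _) [] = refl
  zipWith≡map-zip F (a ∷ xs) (τ ∷ ys) = cong (map (F a +_) τ ∷_) (zipWith≡map-zip F xs ys)

weight-mono : ∀ q {a b} → a ≤ b → weight a q ≤ weight b q
weight-mono (c , τ) {a} {b} a≤b with c <ᵇ a in ea | c <ᵇ b in eb
... | true  | true  = ≤-refl
... | false | _     = z≤n
... | true  | false = ⊥-elim (subst T eb (<⇒<ᵇ (<-≤-trans (<ᵇ≡true⇒< ea) a≤b)))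

offsets-mono : ∀ ps {a b} → a ≤ b → offsets ps a ≤ offsets ps b
offsets-mono []       a≤b = z≤n
offsets-mono (q ∷ ps) a≤b = +-mono-≤ (weight-mono q a≤b) (offsets-mono ps a≤b)

offsets≤size : ∀ ps a → offsets ps a ≤ size ps
offsets≤size [] a = z≤n
offsets≤size ((c , τ) ∷ ps) a = +-mono-≤ weight≤length (offsets≤size ps a)
  where
  weight≤length : weight a (c , τ) ≤ length τ
  weight≤length with c <ᵇ a
  ... | true  = ≤-refl
  ... | false = z≤n

offsets-step : ∀ ps {a τ} → (a , τ) ∈ ps → offsets ps a + length τ ≤ offsets ps (suc a)
offsets-step ((a , τ) ∷ ps) (here refl) rewrite n<ᵇn≡false a | <⇒<ᵇ≡true (n<1+n a) =
  subst (_≤ length τ + offsets ps (suc a)) (+-comm (length τ) (offsets ps a))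
    (+-monoʳ-≤ (length τ) (offsets-mono ps (n≤1+n a)))
offsets-step (q ∷ ps) {a} {τ} (there p∈ps) =
  subst (_≤ weight (suc a) q + offsets ps (suc a)) (sym (+-assoc (weight a q) (offsets ps a) (length τ)))
    (+-mono-≤ (weight-mono q (n≤1+n a)) (offsets-step ps p∈ps))

length-inflateBlocks : ∀ ps → length (inflateBlocks ps) ≡ size ps
length-inflateBlocks ps = go ps
  where
  go : ∀ qs → length (concat (map (shiftedBlock (offsets ps)) qs)) ≡ size qs
  go [] = refl
  go ((c , τ) ∷ qs) = trans (length-++ (map (offsets ps c +_) τ))
                            (cong₂ _+_ (length-map (offsets ps c +_) τ) (go qs))

Monotone : (ℕ → ℕ) → Set
Monotone f = ∀ {a b} → a ≤ b → f a ≤ f b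

-- Block a of an inflation occupies the values in [F a, F (a + 1)).
InInterval : (ℕ → ℕ) → ℕ → ℕ → Set
InInterval F a x = (F a ≤ x) × (x < F (suc a))

interval-< : ∀ {F} → Monotone F → ∀ {a b x y} → InInterval F a x → InInterval F b y → a < b → x < y
interval-< mono (_ , x<) (≤y , _) a<b = <-≤-trans x< (≤-trans (mono a<b) ≤y)

interval-≢ : ∀ {F} → Monotone F → ∀ {a b x y} → InInterval F a x → InInterval F b y → a ≢ b → x ≢ y
interval-≢ mono {a} {b} x∈ y∈ a≢b with <-cmp a b
... | tri< a<b _ _ = <⇒≢ (interval-< mono x∈ y∈ a<b)
... | tri≈ _ a≡b _ = ⊥-elim (a≢b a≡b)
... | tri> _ _ b<a = ≢-sym (<⇒≢ (interval-< mono y∈ x∈ b<a))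

shiftedBlock-inInterval : ∀ ps {a τ u} → (a , τ) ∈ ps → All (_< length τ) u →
  All (InInterval (offsets ps) a) (shiftedBlock (offsets ps) (a , u))
shiftedBlock-inInterval ps {a} p∈ps u<τ = All.map⁺ (All.map (λ {t} t< →
  m≤m+n (offsets ps a) t , <-≤-trans (+-monoʳ-< (offsets ps a) t<) (offsets-step ps p∈ps)) u<τ)

inflateBlocks-isPerm : ∀ ps → Unique (map proj₁ ps) → All (IsPerm ∘ proj₂) ps → IsPerm (inflateBlocks ps)
inflateBlocks-isPerm ps labels-unique perms = subst (λ n → inflateBlocks ps ↭ upTo n) (sym (length-inflateBlocks ps))
  (unique-bounded⇒↭upTo (size ps) unique bounded (length-inflateBlocks ps))
  where
  F = offsets ps
  inIntervals : All (λ p → All (InInterval F (proj₁ p)) (shiftedBlock F p)) ps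
  inIntervals = All.tabulate (λ p∈ps → shiftedBlock-inInterval ps p∈ps (isPerm⇒bounded (All.lookup perms p∈ps)))
  bounded : All (_< size ps) (inflateBlocks ps)
  bounded = All.concat⁺ (All.map⁺ (All.map (λ {p} →
    All.map (λ (_ , x<) → <-≤-trans x< (offsets≤size ps (suc (proj₁ p))))) inIntervals))
  blocks-unique : All (Unique ∘ shiftedBlock F) ps
  blocks-unique = All.map (λ {p} τ-perm →
    Unique.map⁺ (+-cancelˡ-≡ (F (proj₁ p)) _ _) (isPerm⇒unique τ-perm)) perms
  blocks-disjoint : ∀ {qs} → AllPairs (λ p q → proj₁ p ≢ proj₁ q) qs →
    All (λ p → All (InInterval F (proj₁ p)) (shiftedBlock F p)) qs →
    AllPairs (λ p q → All (λ x → All (x ≢_) (shiftedBlock F q)) (shiftedBlock F p)) qs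
  blocks-disjoint [] [] = []
  blocks-disjoint (a≢ ∷ a≢s) (p∈ ∷ ins) = All.zipWith (λ (a≢b , q∈) →
    All.map (λ x∈ → All.map (λ y∈ → interval-≢ (offsets-mono ps) x∈ y∈ a≢b) q∈) p∈) (a≢ , ins)
    ∷ blocks-disjoint a≢s ins
  unique : Unique (inflateBlocks ps)
  unique = AllPairs.concat⁺ (All.map⁺ blocks-unique)
    (AllPairs.map⁺ (blocks-disjoint (AllPairs.map⁻ labels-unique) inIntervals))

orderIso-++ : ∀ {B C R R′} → OrderIso B C → OrderIso R R′ →
  Pointwise (λ x y → AgreeAll x y R R′) B C → OrderIso (B ++ R) (C ++ R′)
orderIso-++ [] isoR [] = isoR
orderIso-++ (xy ∷ iso) isoR (xyR ∷ xyRs) = Pointwise.++⁺ xy xyR ∷ orderIso-++ iso isoR xyRs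

-- Values in different blocks compare as the labels of their blocks do.
module _ {A : Set} {F G : ℕ → ℕ} (F-mono : Monotone F) (G-mono : Monotone G)
         (labelˡ labelʳ : A → ℕ) (blockˡ blockʳ : A → List ℕ) where

  BlocksMatch : A → Set
  BlocksMatch q = OrderIso (blockˡ q) (blockʳ q) ×
                  All (InInterval F (labelˡ q)) (blockˡ q) × All (InInterval G (labelʳ q)) (blockʳ q)

  private
    agreeAll-pointwise : ∀ {x y B C} {P Q : ℕ → Set} → OrderIso B C → All P B → All Q C →
      (∀ {x′ y′} → P x′ → Q y′ → Agree x y x′ y′) → AgreeAll x y B C
    agreeAll-pointwise [] [] [] agree = []
    agreeAll-pointwise (_ ∷ iso) (p ∷ ps) (q ∷ qs) agree = agree p q ∷ agreeAll-pointwise iso ps qs agree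

    agree-otherBlock : ∀ {a b x y} q → InInterval F a x → InInterval G b y → a ≢ labelˡ q →
      Agree a b (labelˡ q) (labelʳ q) → BlocksMatch q → AgreeAll x y (blockˡ q) (blockʳ q)
    agree-otherBlock {a} {b} q x∈ y∈ a≢a′ (lo , hi) (iso , B′∈ , C′∈) with <-cmp a (labelˡ q)
    ... | tri≈ _ a≡a′ _ = ⊥-elim (a≢a′ a≡a′)
    ... | tri< a<a′ _ _ = agreeAll-pointwise iso B′∈ C′∈ λ x′∈ y′∈ →
      agree-< (interval-< F-mono x∈ x′∈ a<a′) (interval-< G-mono y∈ y′∈ b<b′)
      where
      b<b′ : b < labelʳ q
      b<b′ = <ᵇ≡true⇒< (trans (sym hi) (<⇒<ᵇ≡true a<a′))
    ... | tri> _ _ a′<a = agreeAll-pointwise iso B′∈ C′∈ λ x′∈ y′∈ →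
      agree-> (interval-< F-mono x′∈ x∈ a′<a) (interval-< G-mono y′∈ y∈ b′<b)
      where
      b′<b : labelʳ q < b
      b′<b = <ᵇ≡true⇒< (trans (sym lo) (<⇒<ᵇ≡true a′<a))

    agree-laterBlocks : ∀ {a b x y qs} → All BlocksMatch qs →
      AgreeAll a b (map labelˡ qs) (map labelʳ qs) → All (a ≢_) (map labelˡ qs) →
      InInterval F a x → InInterval G b y → AgreeAll x y (concat (map blockˡ qs)) (concat (map blockʳ qs))
    agree-laterBlocks [] [] [] x∈ y∈ = []
    agree-laterBlocks {qs = q ∷ _} (m ∷ ms) (ab ∷ abs) (a≢ ∷ a≢s) x∈ y∈ =
      Pointwise.++⁺ (agree-otherBlock q x∈ y∈ a≢ ab m) (agree-laterBlocks ms abs a≢s x∈ y∈)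

    pointwise-inIntervals : ∀ {a b B C R R′} → OrderIso B C → All (InInterval F a) B → All (InInterval G b) C →
      (∀ {x y} → InInterval F a x → InInterval G b y → AgreeAll x y R R′) →
      Pointwise (λ x y → AgreeAll x y R R′) B C
    pointwise-inIntervals [] [] [] agree = []
    pointwise-inIntervals (_ ∷ iso) (p ∷ ps) (q ∷ qs) agree = agree p q ∷ pointwise-inIntervals iso ps qs agree

  orderIso-concat : ∀ {qs} → All BlocksMatch qs →
    OrderIso (map labelˡ qs) (map labelʳ qs) → Unique (map labelˡ qs) →
    OrderIso (concat (map blockˡ qs)) (concat (map blockʳ qs))
  orderIso-concat [] [] [] = []
  orderIso-concat ((iso , B∈ , C∈) ∷ ms) (ab ∷ labels-iso) (a∉ ∷ labels-unique) =
    orderIso-++ iso (orderIso-concat ms labels-iso labels-unique)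
      (pointwise-inIntervals iso B∈ C∈ (agree-laterBlocks ms ab a∉))

concat-shiftedBlocks-+ : ∀ (F G : ℕ → ℕ) k qs → All (λ q → F (proj₁ q) ≡ k + G (proj₁ q)) qs →
  concat (map (shiftedBlock F) qs) ≡ map (k +_) (concat (map (shiftedBlock G) qs))
concat-shiftedBlocks-+ F G k [] [] = refl
concat-shiftedBlocks-+ F G k ((c , τ) ∷ qs) (e ∷ es) = begin
  map (F c +_) τ ++ concat (map (shiftedBlock F) qs)
    ≡⟨ cong₂ _++_ (trans (cong (λ m → map (m +_) τ) e) (map-+-assoc τ)) (concat-shiftedBlocks-+ F G k qs es) ⟩
  map (k +_) (map (G c +_) τ) ++ map (k +_) (concat (map (shiftedBlock G) qs))
    ≡⟨ sym (map-++ (k +_) (map (G c +_) τ) _) ⟩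
  map (k +_) (concat (map (shiftedBlock G) ((c , τ) ∷ qs))) ∎
  where
  open ≡-Reasoning
  map-+-assoc : ∀ xs → map ((k + G c) +_) xs ≡ map (k +_) (map (G c +_) xs)
  map-+-assoc xs = trans (map-cong (+-assoc k (G c)) xs) (map-∘ xs)

-- Inflations are closed under containment

⊆-++-split : ∀ (xs : List ℕ) {ys s} → s ⊆ xs ++ ys →
  Σ (List ℕ) λ s₁ → Σ (List ℕ) λ s₂ → (s ≡ s₁ ++ s₂) × (s₁ ⊆ xs) × (s₂ ⊆ ys)
⊆-++-split [] {s = s} p = [] , s , refl , [] , p
⊆-++-split (x ∷ xs) (.x ∷ʳ p) with ⊆-++-split xs p
... | s₁ , s₂ , refl , p₁ , p₂ = s₁ , s₂ , refl , x ∷ʳ p₁ , p₂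
⊆-++-split (x ∷ xs) (refl ∷ p) with ⊆-++-split xs p
... | s₁ , s₂ , refl , p₁ , p₂ = x ∷ s₁ , s₂ , refl , refl ∷ p₁ , p₂

⊆-map-split : ∀ (f : ℕ → ℕ) xs {s} → s ⊆ map f xs → Σ (List ℕ) λ u → (u ⊆ xs) × (s ≡ map f u)
⊆-map-split f [] [] = [] , [] , refl
⊆-map-split f (x ∷ xs) (_ ∷ʳ p) with ⊆-map-split f xs p
... | u , u⊆ , refl = u , x ∷ʳ u⊆ , refl
⊆-map-split f (x ∷ xs) (refl ∷ p) with ⊆-map-split f xs p
... | u , u⊆ , refl = x ∷ u , refl ∷ u⊆ , refl

SubBlockOf : List Block → Block → Set
SubBlockOf ps (a , u) = Σ Perm λ τ → ((a , τ) ∈ ps) × (u ⊆ τ) × (u ≢ [])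

subBlockOf-∷ : ∀ {p ps q} → SubBlockOf ps q → SubBlockOf (p ∷ ps) q
subBlockOf-∷ (τ , p∈ps , u⊆τ , u≢[]) = τ , there p∈ps , u⊆τ , u≢[]

⊆-inflation-split : ∀ F ps {s} → s ⊆ concat (map (shiftedBlock F) ps) →
  Σ (List Block) λ qs → (map proj₁ qs ⊆ map proj₁ ps) × All (SubBlockOf ps) qs ×
                        (s ≡ concat (map (shiftedBlock F) qs))
⊆-inflation-split F [] [] = [] , [] , [] , refl
⊆-inflation-split F ((a , τ) ∷ ps) p with ⊆-++-split (map (F a +_) τ) p
... | s₁ , s₂ , refl , p₁ , p₂ with ⊆-map-split (F a +_) τ p₁ | ⊆-inflation-split F ps p₂
... | [] , _ , refl | qs , labels⊆ , subs , refl =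
  qs , a ∷ʳ labels⊆ , All.map subBlockOf-∷ subs , refl
... | t ∷ u , u⊆ , refl | qs , labels⊆ , subs , refl =
  (a , t ∷ u) ∷ qs , refl ∷ labels⊆ , (τ , here refl , u⊆ , λ ()) ∷ All.map subBlockOf-∷ subs , refl

standardiseBlock : List ℕ → Block → Block
standardiseBlock L (a , u) = rank L a , st u

labels-standardised : ∀ qs → map proj₁ (map (standardiseBlock (map proj₁ qs)) qs) ≡ st (map proj₁ qs)
labels-standardised qs = trans (sym (map-∘ qs)) (map-∘ qs)

module _ {ps : List Block} (perms : All (IsPerm ∘ proj₂) ps) where

  subBlock-unique : ∀ {q} → SubBlockOf ps q → Unique (proj₂ q)
  subBlock-unique (τ , p∈ps , u⊆τ , _) = AllPairs-resp-⊆ u⊆τ (isPerm⇒unique (All.lookup perms p∈ps))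

  standardised-isPerm : ∀ {qs} → Unique (map proj₁ qs) → All (SubBlockOf ps) qs →
    IsPerm (inflateBlocks (map (standardiseBlock (map proj₁ qs)) qs))
  standardised-isPerm {qs} labels-unique subs = inflateBlocks-isPerm _
    (subst Unique (sym (labels-standardised qs)) (isPerm⇒unique (st-isPerm labels-unique)))
    (All.map⁺ (All.map (st-isPerm ∘ subBlock-unique) subs))

  orderIso-standardised : ∀ {qs} → Unique (map proj₁ qs) → All (SubBlockOf ps) qs →
    OrderIso (concat (map (shiftedBlock (offsets ps)) qs))
             (inflateBlocks (map (standardiseBlock (map proj₁ qs)) qs))
  orderIso-standardised {qs} labels-unique subs =
    subst (OrderIso _) (cong concat (map-∘ qs))
      (orderIso-concat (offsets-mono ps) (offsets-mono ps″) proj₁ (rank L ∘ proj₁)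
        (shiftedBlock (offsets ps)) (shiftedBlock (offsets ps″) ∘ standardiseBlock L)
        (All.tabulate (λ q∈qs → match q∈qs (All.lookup subs q∈qs)))
        (subst (OrderIso L) (sym (map-∘ qs)) (orderIso-st L)) labels-unique)
    where
    L = map proj₁ qs
    ps″ = map (standardiseBlock L) qs
    match : ∀ {q} → q ∈ qs → SubBlockOf ps q →
      BlocksMatch (offsets-mono ps) (offsets-mono ps″) proj₁ (rank L ∘ proj₁)
        (shiftedBlock (offsets ps)) (shiftedBlock (offsets ps″) ∘ standardiseBlock L) q
    match {a , u} q∈qs sub@(τ , p∈ps , u⊆τ , _) =
      orderIso-shift (offsets ps a) (offsets ps″ (rank L a)) (orderIso-st u) ,
      shiftedBlock-inInterval ps p∈ps (All-resp-⊆ u⊆τ (isPerm⇒bounded (All.lookup perms p∈ps))) ,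
      shiftedBlock-inInterval ps″ (∈-map⁺ (standardiseBlock L) q∈qs)
        (isPerm⇒bounded (st-isPerm (subBlock-unique sub)))

map-proj₁-zip : ∀ {B : Set} (xs : List ℕ) (ys : List B) → length ys ≡ length xs → map proj₁ (zip xs ys) ≡ xs
map-proj₁-zip [] [] _ = refl
map-proj₁-zip (x ∷ xs) (y ∷ ys) len = cong (x ∷_) (map-proj₁-zip xs ys (suc-injective len))

zip-map-proj : ∀ (ps : List Block) → zip (map proj₁ ps) (map proj₂ ps) ≡ ps
zip-map-proj [] = refl
zip-map-proj (p ∷ ps) = cong (p ∷_) (zip-map-proj ps)

All-zip₂ : ∀ {B : Set} {P : B → Set} (xs : List ℕ) {ys : List B} → All P ys → All (P ∘ proj₂) (zip xs ys)
All-zip₂ [] _ = []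
All-zip₂ (x ∷ xs) [] = []
All-zip₂ (x ∷ xs) (p ∷ ps) = p ∷ All-zip₂ xs ps

All-zip₁ : ∀ {B : Set} {P : ℕ → Set} {xs : List ℕ} (ys : List B) → All P xs → All (P ∘ proj₁) (zip xs ys)
All-zip₁ ys [] = []
All-zip₁ [] (p ∷ ps) = []
All-zip₁ (y ∷ ys) (p ∷ ps) = p ∷ All-zip₁ ys ps

st-nonempty : ∀ {u} → u ≢ [] → st u ≢ []
st-nonempty {[]} u≢[] = ⊥-elim (u≢[] refl)
st-nonempty {_ ∷ _} _ = λ ()

inflation-onlyPerms : ∀ {C E} → OnlyPerms C → OnlyPerms E → OnlyPerms (C [ E ])
inflation-onlyPerms C-perms E-perms (σ , τs , Cσ , len , Es , refl) =
  subst IsPerm (sym (inflate≡inflateBlocks σ τs))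
    (inflateBlocks-isPerm (zip σ τs) (subst Unique (sym (map-proj₁-zip σ τs len)) (isPerm⇒unique (C-perms Cσ)))
      (All-zip₂ σ (All.map (E-perms ∘ proj₁) Es)))

inflation-closed : ∀ {C E} → ContainmentClosed C → OnlyPerms C → ContainmentClosed E → OnlyPerms E →
  ContainmentClosed (C [ E ])
inflation-closed {C} {E} C-closed C-perms E-closed E-perms (σ , τs , Cσ , len , Es , refl) (s , s⊆ , refl)
  with ⊆-inflation-split (offsets (zip σ τs)) (zip σ τs) (subst (s ⊆_) (inflate≡inflateBlocks σ τs) s⊆)
... | qs , labels⊆ , subs , refl =
  map proj₁ ps″ , map proj₂ ps″ , C-σ′ , length-τs′ , E-τs′ , inflate≡st
  where
  ps = zip σ τs
  L = map proj₁ qs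
  ps″ = map (standardiseBlock L) qs
  perms : All (IsPerm ∘ proj₂) ps
  perms = All-zip₂ σ (All.map (E-perms ∘ proj₁) Es)
  L⊆σ : L ⊆ σ
  L⊆σ = subst (L ⊆_) (map-proj₁-zip σ τs len) labels⊆
  L-unique : Unique L
  L-unique = AllPairs-resp-⊆ L⊆σ (isPerm⇒unique (C-perms Cσ))
  C-σ′ : C (map proj₁ ps″)
  C-σ′ = subst C (sym (labels-standardised qs)) (C-closed Cσ (L , L⊆σ , refl))
  length-τs′ : length (map proj₂ ps″) ≡ length (map proj₁ ps″)
  length-τs′ = trans (length-map proj₂ ps″) (sym (length-map proj₁ ps″))
  E-block : ∀ {a τ} → (a , τ) ∈ ps → E τ
  E-block p∈ps = proj₁ (All.lookup (All-zip₂ σ Es) p∈ps)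
  E-τs′ : All (λ τ → E τ × τ ≢ []) (map proj₂ ps″)
  E-τs′ = All.map⁺ (All.map⁺ (All.map (λ { {_ , u} (τ , p∈ps , u⊆τ , u≢[]) →
    E-closed (E-block p∈ps) (u , u⊆τ , refl) , st-nonempty u≢[] }) subs))
  inflate≡st : inflate (map proj₁ ps″) (map proj₂ ps″) ≡ st (concat (map (shiftedBlock (offsets ps)) qs))
  inflate≡st = begin
    inflate (map proj₁ ps″) (map proj₂ ps″)
      ≡⟨ inflate≡inflateBlocks (map proj₁ ps″) (map proj₂ ps″) ⟩
    inflateBlocks (zip (map proj₁ ps″) (map proj₂ ps″))
      ≡⟨ cong inflateBlocks (zip-map-proj ps″) ⟩
    inflateBlocks ps″
      ≡⟨ sym (st-fixes-perm (standardised-isPerm perms L-unique subs)) ⟩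
    st (inflateBlocks ps″)
      ≡⟨ sym (st-cong (orderIso-standardised perms L-unique subs)) ⟩
    st (concat (map (shiftedBlock (offsets ps)) qs)) ∎
    where open ≡-Reasoning

Av-singleton : ∀ {b c β} → Av (b ∷ c ∷ β) (0 ∷ [])
Av-singleton = ↭-refl , λ { ([] , _ , ()) ; (_ ∷ [] , refl ∷ [] , ()) }

letterClass-singleton : ∀ l → letterClass l (0 ∷ [])
letterClass-singleton I     = refl
letterClass-singleton D     = refl
letterClass-singleton Av213 = Av-singleton
letterClass-singleton Av312 = Av-singleton
letterClass-singleton Av132 = Av-singleton
letterClass-singleton Av231 = Av-singleton

letterClass-onlyPerms : ∀ l → OnlyPerms (letterClass l)
letterClass-onlyPerms I     = Incr-onlyPerms
letterClass-onlyPerms D     = Decr-onlyPerms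
letterClass-onlyPerms Av213 = proj₁
letterClass-onlyPerms Av312 = proj₁
letterClass-onlyPerms Av132 = proj₁
letterClass-onlyPerms Av231 = proj₁

letterClass-closed : ∀ l → ContainmentClosed (letterClass l)
letterClass-closed I     = Incr-closed
letterClass-closed D     = Decr-closed
letterClass-closed Av213 = Av-closed _
letterClass-closed Av312 = Av-closed _
letterClass-closed Av132 = Av-closed _
letterClass-closed Av231 = Av-closed _

represent-singleton : ∀ w → represent w (0 ∷ [])
represent-singleton [] = inj₂ refl
represent-singleton (l ∷ w) =
  0 ∷ [] , (0 ∷ []) ∷ [] , letterClass-singleton l , refl , (represent-singleton w , λ ()) ∷ [] , refl

represent-onlyPerms : ∀ w → OnlyPerms (represent w)
represent-onlyPerms [] (inj₁ refl) = ↭-refl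
represent-onlyPerms [] (inj₂ refl) = ↭-refl
represent-onlyPerms (l ∷ w) = inflation-onlyPerms (letterClass-onlyPerms l) (represent-onlyPerms w)

represent-closed : ∀ w → ContainmentClosed (represent w)
represent-closed [] (inj₁ refl) ([] , [] , refl) = inj₁ refl
represent-closed [] (inj₂ refl) ([] , _ , refl) = inj₁ refl
represent-closed [] (inj₂ refl) (_ ∷ [] , refl ∷ [] , refl) = inj₂ refl
represent-closed (l ∷ w) = inflation-closed (letterClass-closed l) (letterClass-onlyPerms l)
  (represent-closed w) (represent-onlyPerms w)

-- Prepending a new maximum

MaxPrependClosed : PermClass → Set
MaxPrependClosed C = ∀ π → C π → C (length π ∷ π)

offsets-all-below : ∀ ps a → All ((_< a) ∘ proj₁) ps → offsets ps a ≡ size ps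
offsets-all-below [] a [] = refl
offsets-all-below ((c , τ) ∷ ps) a (c<a ∷ below) rewrite <⇒<ᵇ≡true c<a =
  cong (length τ +_) (offsets-all-below ps a below)

-- Inflate the new maximum of σ by the singleton.
inflation-maxPrependClosed : ∀ {C E} → OnlyPerms C → MaxPrependClosed C → E (0 ∷ []) →
  MaxPrependClosed (C [ E ])
inflation-maxPrependClosed C-perms C-prepend E-one _ (σ , τs , Cσ , len , Es , refl) =
  length σ ∷ σ , (0 ∷ []) ∷ τs , C-prepend σ Cσ , cong suc len , (E-one , λ ()) ∷ Es , inflate≡
  where
  n = length σ
  ps = zip σ τs
  ps′ = (n , 0 ∷ []) ∷ ps
  below : All ((_< n) ∘ proj₁) ps
  below = All-zip₁ τs (isPerm⇒bounded (C-perms Cσ))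
  top : offsets ps′ n + 0 ≡ length (inflate σ τs)
  top rewrite n<ᵇn≡false n = begin
    offsets ps n + 0            ≡⟨ +-identityʳ _ ⟩
    offsets ps n                ≡⟨ offsets-all-below ps n below ⟩
    size ps                     ≡⟨ sym (length-inflateBlocks ps) ⟩
    length (inflateBlocks ps)   ≡⟨ cong length (sym (inflate≡inflateBlocks σ τs)) ⟩
    length (inflate σ τs)       ∎
    where open ≡-Reasoning
  others-unchanged : All (λ q → offsets ps′ (proj₁ q) ≡ 0 + offsets ps (proj₁ q)) ps
  others-unchanged = All.map unchanged below
    where
    unchanged : ∀ {c} → c < n → offsets ps′ c ≡ offsets ps c
    unchanged {c} c<n rewrite ≮⇒<ᵇ≡false (<⇒≯ c<n) = refl
  inflate≡ : inflate (n ∷ σ) ((0 ∷ []) ∷ τs) ≡ length (inflate σ τs) ∷ inflate σ τs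
  inflate≡ = begin
    inflate (n ∷ σ) ((0 ∷ []) ∷ τs)
      ≡⟨ inflate≡inflateBlocks (n ∷ σ) ((0 ∷ []) ∷ τs) ⟩
    inflateBlocks ps′
      ≡⟨ cong₂ _∷_ top (trans (concat-shiftedBlocks-+ (offsets ps′) (offsets ps) 0 ps others-unchanged)
                              (map-id (inflateBlocks ps))) ⟩
    length (inflate σ τs) ∷ inflateBlocks ps
      ≡⟨ cong (length (inflate σ τs) ∷_) (sym (inflate≡inflateBlocks σ τs)) ⟩
    length (inflate σ τs) ∷ inflate σ τs ∎
    where open ≡-Reasoning

isPerm-prependMax : ∀ {π} → IsPerm π → IsPerm (length π ∷ π)
isPerm-prependMax {π} π-perm = ↭-trans (prep (length π) π-perm) (∷-upTo↭upTo-suc (length π))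

Decr-maxPrependClosed : MaxPrependClosed Decr
Decr-maxPrependClosed π π≡ = begin
  length π ∷ π                        ≡⟨ cong (length π ∷_) (trans π≡ (reverse-upTo (length π))) ⟩
  downFrom (suc (length π))           ≡⟨ sym (reverse-upTo (suc (length π))) ⟩
  reverse (upTo (suc (length π)))     ∎
  where open ≡-Reasoning

-- An occurrence of b ∷ β using the new maximum would force b = length β.
Av-maxPrependClosed : ∀ b β → b ≢ length β → MaxPrependClosed (Av (b ∷ β))
Av-maxPrependClosed b β b≢ π (π-perm , β⋠π) = isPerm-prependMax π-perm , avoids
  where
  n = length π
  avoids : ¬ ((b ∷ β) ≼ (n ∷ π))
  avoids (s , _ ∷ʳ s⊆π , st≡) = β⋠π (s , s⊆π , st≡)
  avoids (_ ∷ s , refl ∷ s⊆π , st≡) = b≢ (begin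
    b                ≡⟨ sym (∷-injectiveˡ st≡) ⟩
    rank (n ∷ s) n   ≡⟨ rank-∷ n s n ⟩
    (if n <ᵇ n then suc (rank s n) else rank s n)
                     ≡⟨ cong (λ c → if c then suc (rank s n) else rank s n) (n<ᵇn≡false n) ⟩
    rank s n         ≡⟨ rank-of-bound s (All-resp-⊆ s⊆π (isPerm⇒bounded π-perm)) ⟩
    length s         ≡⟨ sym (length-map (rank (n ∷ s)) s) ⟩
    length (map (rank (n ∷ s)) s) ≡⟨ cong length (∷-injectiveʳ st≡) ⟩
    length β         ∎)
    where open ≡-Reasoning

letterClass-maxPrependClosed : ∀ l → forbidden I l ≡ false → MaxPrependClosed (letterClass l)
letterClass-maxPrependClosed I     ()
letterClass-maxPrependClosed Av312 ()
letterClass-maxPrependClosed Av231 ()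
letterClass-maxPrependClosed D     _ = Decr-maxPrependClosed
letterClass-maxPrependClosed Av213 _ = Av-maxPrependClosed 1 (0 ∷ 2 ∷ []) (λ ())
letterClass-maxPrependClosed Av132 _ = Av-maxPrependClosed 0 (2 ∷ 1 ∷ []) (λ ())

maxFirst-sumIndecomposable : ∀ π → SumIndecomposable (length π ∷ π)
maxFirst-sumIndecomposable π = (λ ()) , indecomposable
  where
  indecomposable : ∀ α β → IsPerm α → IsPerm β → α ≢ [] → β ≢ [] → α ⊕ β ≢ (length π ∷ π)
  indecomposable [] _ _ _ α≢[] _ _ = α≢[] refl
  indecomposable _ [] _ _ _ β≢[] _ = β≢[] refl
  indecomposable α@(a ∷ _) β@(_ ∷ _) α-perm _ _ _ α⊕β≡ = <⇒≢ a<n (∷-injectiveˡ α⊕β≡)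
    where
    lengths : length α + length β ≡ suc (length π)
    lengths = begin
      length α + length β                    ≡⟨ cong (length α +_) (sym (length-map (length α +_) β)) ⟩
      length α + length (map (length α +_) β) ≡⟨ sym (length-++ α) ⟩
      length (α ⊕ β)                         ≡⟨ cong length α⊕β≡ ⟩
      suc (length π)                         ∎
      where open ≡-Reasoning
    a<n : a < length π
    a<n = <-≤-trans (All.head (isPerm⇒bounded α-perm))
            (≤-pred (subst (length α <_) lengths (m<m+n (length α) z<s)))

-- Direct sums

offsets-zero : ∀ ps → offsets ps 0 ≡ 0
offsets-zero [] = refl
offsets-zero (_ ∷ ps) = offsets-zero ps

offsets-relabel : ∀ ps a → offsets (map (Product.map₁ suc) ps) (suc a) ≡ offsets ps a
offsets-relabel [] a = refl
offsets-relabel (p ∷ ps) a = cong (weight a p +_) (offsets-relabel ps a)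

inflate-upTo-suc : ∀ m τ τs → inflate (upTo (suc m)) (τ ∷ τs) ≡ τ ⊕ inflate (upTo m) τs
inflate-upTo-suc m τ τs = begin
  inflate (upTo (suc m)) (τ ∷ τs)
    ≡⟨ inflate≡inflateBlocks (upTo (suc m)) (τ ∷ τs) ⟩
  inflateBlocks ((0 , τ) ∷ zip (applyUpTo suc m) τs)
    ≡⟨ cong (λ qs → inflateBlocks ((0 , τ) ∷ qs)) labels-shifted ⟩
  inflateBlocks ((0 , τ) ∷ map (Product.map₁ suc) ps)
    ≡⟨ cong₂ _++_ first-block later-blocks ⟩
  τ ⊕ inflateBlocks ps
    ≡⟨ cong (τ ⊕_) (sym (inflate≡inflateBlocks (upTo m) τs)) ⟩
  τ ⊕ inflate (upTo m) τs ∎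
  where
  open ≡-Reasoning
  ps = zip (upTo m) τs
  F = offsets ((0 , τ) ∷ map (Product.map₁ suc) ps)
  labels-shifted : zip (applyUpTo suc m) τs ≡ map (Product.map₁ suc) ps
  labels-shifted = begin
    zip (applyUpTo suc m) τs            ≡⟨ cong₂ zip (sym (map-upTo suc m)) (sym (map-id τs)) ⟩
    zip (map suc (upTo m)) (map id τs)  ≡⟨ zip-map suc id (upTo m) τs ⟩
    map (Product.map₁ suc) ps           ∎
  first-block : map (F 0 +_) τ ≡ τ
  first-block = trans (cong (λ k → map (k +_) τ) (offsets-zero (map (Product.map₁ suc) ps))) (map-id τ)
  later-blocks : concat (map (shiftedBlock F) (map (Product.map₁ suc) ps)) ≡ map (length τ +_) (inflateBlocks ps)
  later-blocks = trans (cong concat (sym (map-∘ ps)))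
    (concat-shiftedBlocks-+ (F ∘ suc) (offsets ps) (length τ) ps
      (All.tabulate (λ {q} _ → cong (length τ +_) (offsets-relabel ps (proj₁ q)))))

⊕-nonempty : ∀ {α β} → α ≢ [] → α ⊕ β ≢ []
⊕-nonempty {[]} α≢[] = ⊥-elim (α≢[] refl)
⊕-nonempty {_ ∷ _} _ = λ ()

inflate-upTo-one : ∀ τ → inflate (upTo 1) (τ ∷ []) ≡ τ
inflate-upTo-one τ = trans (inflate-upTo-suc 0 τ []) (++-identityʳ τ)

Incr-singleton-inflation : ∀ {E σ} → E σ → σ ≢ [] → (Incr [ E ]) σ
Incr-singleton-inflation {σ = σ} Eσ σ≢[] =
  upTo 1 , σ ∷ [] , refl , refl , (Eσ , σ≢[]) ∷ [] , inflate-upTo-one σ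

sumIndecomposable-Incr-inflation : ∀ {E σ} → OnlyPerms E → SumIndecomposable σ → (Incr [ E ]) σ → E σ
sumIndecomposable-Incr-inflation {E} {σ} E-perms (σ≢[] , indecomposable) (ρ , τs , ρ≡ , len , Es , σ≡) =
  blocks τs (trans ρ≡ (cong upTo (sym len))) Es σ≡
  where
  blocks : ∀ {ρ} τs → ρ ≡ upTo (length τs) → All (λ τ → E τ × τ ≢ []) τs → inflate ρ τs ≡ σ → E σ
  blocks [] refl _ refl = ⊥-elim (σ≢[] refl)
  blocks (τ ∷ []) refl ((Eτ , _) ∷ []) refl = subst E (sym (inflate-upTo-one τ)) Eτ
  blocks (τ ∷ τ′ ∷ τs) refl ((Eτ , τ≢[]) ∷ Es) refl =
    ⊥-elim (indecomposable τ rest (E-perms Eτ) rest-perm τ≢[] rest≢[]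
              (sym (inflate-upTo-suc k τ (τ′ ∷ τs))))
    where
    k = suc (length τs)
    rest = inflate (upTo k) (τ′ ∷ τs)
    rest-perm : IsPerm rest
    rest-perm = inflation-onlyPerms Incr-onlyPerms E-perms
      (upTo k , τ′ ∷ τs , cong upTo (sym (length-upTo k)) , sym (length-upTo k) , Es , refl)
    rest≢[] : rest ≢ []
    rest≢[] = subst (_≢ []) (sym (inflate-upTo-suc (length τs) τ′ τs)) (⊕-nonempty (proj₂ (All.head Es)))

≼-prepend : ∀ {π} x → IsPerm π → π ≼ (x ∷ π)
≼-prepend {π} x π-perm = π , x ∷ʳ ⊆-refl , st-fixes-perm π-perm

-- Unless xs is empty, the witness is π with a new maximum placed in front.
sumIndecomposable-above : ∀ xs → Reduced (I ∷ xs) → ∀ {π} → represent xs π →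
  Σ Perm λ σ → SumIndecomposable σ × represent xs σ × (π ≼ σ)
sumIndecomposable-above [] _ π∈ = 0 ∷ [] , maxFirst-sumIndecomposable [] , inj₂ refl , below-one π∈
  where
  below-one : ∀ {π} → represent [] π → π ≼ (0 ∷ [])
  below-one (inj₁ refl) = [] , 0 ∷ʳ [] , refl
  below-one (inj₂ refl) = 0 ∷ [] , refl ∷ [] , refl
sumIndecomposable-above (l ∷ w) (I-l-allowed , _) {π} π∈ =
  length π ∷ π , maxFirst-sumIndecomposable π ,
  inflation-maxPrependClosed (letterClass-onlyPerms l) (letterClass-maxPrependClosed l I-l-allowed)
    (represent-singleton w) π π∈ ,
  ≼-prepend (length π) (represent-onlyPerms (l ∷ w) π∈)

mainTheorem18 : (xs : Word) → Reduced (I ∷ xs) → (π : Perm) →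
    represent xs π ⇔ Σ Perm (λ σ → SumIndecomposable σ × represent (I ∷ xs) σ × (π ≼ σ))
mainTheorem18 xs reduced π = mk⇔ upward downward
  where
  upward : represent xs π → Σ Perm (λ σ → SumIndecomposable σ × represent (I ∷ xs) σ × (π ≼ σ))
  upward π∈ with sumIndecomposable-above xs reduced π∈
  ... | σ , σ-indecomposable , σ∈ , π≼σ =
    σ , σ-indecomposable , Incr-singleton-inflation σ∈ (proj₁ σ-indecomposable) , π≼σ

  downward : Σ Perm (λ σ → SumIndecomposable σ × represent (I ∷ xs) σ × (π ≼ σ)) → represent xs π
  downward (σ , σ-indecomposable , σ∈ , π≼σ) =
    represent-closed xs (sumIndecomposable-Incr-inflation (represent-onlyPerms xs) σ-indecomposable σ∈) π≼σ
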